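{- Let $E=(d_1,\ldots,d_{m-1})$ be an ordered tuple of positive integers with $d_1\le d_2\le\cdots\le d_{m-1}$, and let $d=d_1+\cdots+d_{m-1}$. Then $E$ is valid if and only if for every integer $0\le j\le d-1$ there exists a subset $H_j\subseteq\{2,\ldots,m-1\}$ such that $\sum_{k\in H_j} d_k=j$.
   Context: An ordered tuple $E=(d_1,\ldots,d_{m-1})$ of positive integers (always written in nondecreasing order) is called valid if (i) $d_1=1$ and (ii) $d_2\le d_1$, $d_3\le d_1+d_2$, $\ldots$, $d_{m-1}\le d_1+\cdots+d_{m-2}$ (so in particular $d_1=d_2=1$). We write $d=d(E)=d_1+\cdots+d_{m-1}$. -}

module Defs where

open import Data.Nat using (ℕ; zero; suc; _+_; _≤_; _<_)
open import Data.Fin using (Fin; zero; suc)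
import Data.Fin as F
open import Data.Vec using (_∷_; [])
open import Data.Fin.Subset using (Subset; inside; outside)
open import Data.Product using (_×_)
open import Relation.Binary.PropositionalEquality using (_≡_)

-- A tuple E = (d_1, …, d_{m-1}) is a function  d : Fin (m-1) → ℕ,
-- with d_k = d (k-1) (0-based indexing).

total : ∀ {n} → (Fin n → ℕ) → ℕ
total {zero}  d = 0
total {suc n} d = d zero + total (λ i → d (suc i))

sumBelow : ∀ {n} → (Fin n → ℕ) → Fin n → ℕ
sumBelow d zero    = 0
sumBelow d (suc i) = d zero + sumBelow (λ j → d (suc j)) i

subsetSum : ∀ {n} → Subset n → (Fin n → ℕ) → ℕ
subsetSum []            d = 0
subsetSum (inside  ∷ H) d = d zero + subsetSum H (λ i → d (suc i))
subsetSum (outside ∷ H) d = subsetSum H (λ i → d (suc i))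

Positive : ∀ {n} → (Fin n → ℕ) → Set
Positive d = ∀ i → 0 < d i

Nondecreasing : ∀ {n} → (Fin n → ℕ) → Set
Nondecreasing d = ∀ i j → i F.≤ j → d i ≤ d j

-- Valid: d_1 = 1 and d_k ≤ d_1 + ⋯ + d_{k-1} for all k ≥ 2.
-- (Only defined for nonempty tuples, since condition (i) refers to d_1.)
Valid : ∀ {n} → (Fin (suc n) → ℕ) → Set
Valid {n} d = (d zero ≡ 1) × (∀ (i : Fin n) → d (suc i) ≤ sumBelow d (suc i))

module Submission where

-- Proof idea.  Write e = (d_2, …, d_{m-1}) for the tail of d, so the
-- admissible subsets H (those avoiding the first index) are exactly the
-- subsets of the tail.
--
-- (⇒) Greedy representation with slack: if every e_i is at most
--     c + e_1 + ⋯ + e_{i-1}, then every j < c + Σ e equals a subset sum of e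
--     plus a remainder r < c.  Induction on the length absorbs e_1 into the
--     slack.  For a valid tuple the tail satisfies this with c = d_1 = 1,
--     so the remainder vanishes.
-- (⇐) Gap lemma: for nondecreasing e, no subset sum lies strictly between
--     e_1 + ⋯ + e_{i-1} and e_i.  Representing j = 1 by a subset of the
--     tail, whose entries are all ≥ d_1, forces d_1 = 1; representing
--     j = d_1 + e_1 + ⋯ + e_{i-1} (which is below d) and applying the gap
--     lemma at i forces e_i ≤ d_1 + e_1 + ⋯ + e_{i-1}.

open import Defs
open import Data.Nat using (ℕ; zero; suc; _+_; _∸_; _≤_; _<_; z≤n; s≤s; _<?_)
open import Data.Nat.Properties
open import Data.Fin using (Fin; zero; suc)
open import Data.Fin.Subset using (Subset; _∉_; inside; outside)
open import Data.Vec using (_∷_; []; here)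
open import Data.Vec.Functional using (tail)
open import Data.Sum using (_⊎_; inj₁; inj₂)
open import Data.Product using (Σ; _×_; _,_)
open import Data.Empty using (⊥-elim)
open import Relation.Nullary using (yes; no)
open import Relation.Binary.PropositionalEquality
  using (_≡_; refl; sym; trans; cong; subst; module ≡-Reasoning)
open import Function.Bundles using (_⇔_; mk⇔)

RepresentableAvoidingFirst : ∀ {n} → (Fin (suc n) → ℕ) → ℕ → Set
RepresentableAvoidingFirst {n} d j =
  Σ (Subset (suc n)) (λ H → (zero ∉ H) × (subsetSum H d ≡ j))

representedByTail : ∀ {n} (d : Fin (suc n) → ℕ) j →
  RepresentableAvoidingFirst d j → Σ (Subset n) λ H → subsetSum H (tail d) ≡ j
representedByTail d j (inside  ∷ H , 0∉H , _)  = ⊥-elim (0∉H here)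
representedByTail d j (outside ∷ H , _   , eq) = H , eq

nondecreasing-tail : ∀ {n} (d : Fin (suc n) → ℕ) → Nondecreasing d → Nondecreasing (tail d)
nondecreasing-tail d mono i j i≤j = mono (suc i) (suc j) (s≤s i≤j)

sumBelow+entry≤total : ∀ {n} (e : Fin n → ℕ) (i : Fin n) → sumBelow e i + e i ≤ total e
sumBelow+entry≤total e zero    = m≤m+n (e zero) _
sumBelow+entry≤total e (suc i) =
  subst (_≤ total e) (sym (+-assoc (e zero) _ _))
        (+-monoʳ-≤ (e zero) (sumBelow+entry≤total (tail e) i))

sumBelow<total : ∀ {n} (e : Fin n → ℕ) (i : Fin n) → 0 < e i → sumBelow e i < total e
sumBelow<total e i 0<eᵢ = begin-strict
    sumBelow e i       ≡⟨ sym (+-identityʳ _) ⟩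
    sumBelow e i + 0   <⟨ +-monoʳ-< (sumBelow e i) 0<eᵢ ⟩
    sumBelow e i + e i ≤⟨ sumBelow+entry≤total e i ⟩
    total e            ∎
  where open ≤-Reasoning

-- The first entry is either skipped (remainder already below c)
-- or taken (it fits, since it is at most c ≤ remainder).
representWithSlack : ∀ {n} (e : Fin n → ℕ) c → (∀ i → e i ≤ c + sumBelow e i) →
  ∀ j → j < c + total e → Σ ℕ λ r → r < c × Σ (Subset n) λ H → subsetSum H e + r ≡ j
representWithSlack {zero} e c _ j j<c+0 = j , subst (j <_) (+-identityʳ c) j<c+0 , [] , refl
representWithSlack {suc n} e c bounded j j<c+total
  with representWithSlack (tail e) (c + e zero) boundedTail j
         (subst (j <_) (sym (+-assoc c _ _)) j<c+total)
  where
    boundedTail : ∀ i → tail e i ≤ (c + e zero) + sumBelow (tail e) i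
    boundedTail i = subst (tail e i ≤_) (sym (+-assoc c _ _)) (bounded (suc i))
... | r , r<c+e₀ , H , eq with r <? c
...   | yes r<c = r , r<c , outside ∷ H , eq
...   | no  r≮c = r ∸ e zero , remainder<c , inside ∷ H , takeFirst
  where
    e₀≤r : e zero ≤ r
    e₀≤r = ≤-trans (subst (e zero ≤_) (+-identityʳ c) (bounded zero)) (≮⇒≥ r≮c)

    remainder<c : r ∸ e zero < c
    remainder<c = subst (r ∸ e zero <_) (m+n∸n≡m c (e zero)) (∸-monoˡ-< r<c+e₀ e₀≤r)

    takeFirst : e zero + subsetSum H (tail e) + (r ∸ e zero) ≡ j
    takeFirst = begin
      e zero + subsetSum H (tail e) + (r ∸ e zero)   ≡⟨ cong (_+ (r ∸ e zero)) (+-comm (e zero) _) ⟩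
      subsetSum H (tail e) + e zero + (r ∸ e zero)   ≡⟨ +-assoc (subsetSum H (tail e)) _ _ ⟩
      subsetSum H (tail e) + (e zero + (r ∸ e zero)) ≡⟨ cong (subsetSum H (tail e) +_) (m+[n∸m]≡n e₀≤r) ⟩
      subsetSum H (tail e) + r                       ≡⟨ eq ⟩
      j                                              ∎
      where open ≡-Reasoning

valid⇒representable : ∀ {n} (d : Fin (suc n) → ℕ) → Valid d →
  ∀ j → j < total d → RepresentableAvoidingFirst d j
valid⇒representable d (d₀≡1 , bounded) j j<d
  with representWithSlack (tail d) 1 boundedTail j (subst (λ x → j < x + total (tail d)) d₀≡1 j<d)
  where
    boundedTail : ∀ i → tail d i ≤ 1 + sumBelow (tail d) i
    boundedTail i = subst (λ x → tail d i ≤ x + sumBelow (tail d) i) d₀≡1 (bounded i)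
... | zero  , _       , H , eq = outside ∷ H , (λ ()) , trans (sym (+-identityʳ _)) eq
... | suc _ , s≤s () , _

subsetSum≡0⊎≥ : ∀ {n} (e : Fin n → ℕ) b → (∀ i → b ≤ e i) →
  ∀ H → subsetSum H e ≡ 0 ⊎ b ≤ subsetSum H e
subsetSum≡0⊎≥ e b b≤e []            = inj₁ refl
subsetSum≡0⊎≥ e b b≤e (inside  ∷ H) = inj₂ (≤-trans (b≤e zero) (m≤m+n _ _))
subsetSum≡0⊎≥ e b b≤e (outside ∷ H) = subsetSum≡0⊎≥ (tail e) b (λ i → b≤e (suc i)) H

-- Gap lemma: for nondecreasing e, a subset sum either uses only entries
-- before i (so is at most their sum) or uses an entry from position i on
-- (so is at least e i).
subsetSumGap : ∀ {n} (e : Fin n → ℕ) → Nondecreasing e → (i : Fin n) →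
  ∀ H → subsetSum H e ≤ sumBelow e i ⊎ e i ≤ subsetSum H e
subsetSumGap e mono zero (inside  ∷ H) = inj₂ (m≤m+n _ _)
subsetSumGap e mono zero (outside ∷ H)
  with subsetSum≡0⊎≥ (tail e) (e zero) (λ i → mono zero (suc i) z≤n) H
... | inj₁ ≡0 = inj₁ (≤-reflexive ≡0)
... | inj₂ ≥e₀ = inj₂ ≥e₀
subsetSumGap e mono (suc i) (x ∷ H) with subsetSumGap (tail e) (nondecreasing-tail e mono) i H
subsetSumGap e mono (suc i) (inside  ∷ H) | inj₁ ≤below = inj₁ (+-monoʳ-≤ (e zero) ≤below)
subsetSumGap e mono (suc i) (inside  ∷ H) | inj₂ ≥eᵢ    = inj₂ (≤-trans ≥eᵢ (m≤n+m _ _))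
subsetSumGap e mono (suc i) (outside ∷ H) | inj₁ ≤below = inj₁ (≤-trans ≤below (m≤n+m _ _))
subsetSumGap e mono (suc i) (outside ∷ H) | inj₂ ≥eᵢ    = inj₂ ≥eᵢ

-- (⇐, condition (i)) If 1 < d, then 1 is a tail subset sum; tail entries are
-- at least d_1, so d_1 ≤ 1.  If d ≤ 1, then d_1 ≤ d ≤ 1 directly.
firstIsOne : ∀ {n} (d : Fin (suc n) → ℕ) → Positive d → Nondecreasing d →
  (∀ j → j < total d → RepresentableAvoidingFirst d j) → d zero ≡ 1
firstIsOne d pos mono rep = ≤-antisym d₀≤1 (pos zero)
  where
    d₀≤1 : d zero ≤ 1
    d₀≤1 with 1 <? total d
    ... | no 1≮d = ≤-trans (m≤m+n (d zero) _) (≮⇒≥ 1≮d)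
    ... | yes 1<d with representedByTail d 1 (rep 1 1<d)
    ...   | H , sum≡1 with subsetSum≡0⊎≥ (tail d) (d zero) (λ i → mono zero (suc i) z≤n) H
    ...     | inj₁ sum≡0 = ⊥-elim (0≢1+n (trans (sym sum≡0) sum≡1))
    ...     | inj₂ d₀≤sum = subst (d zero ≤_) sum≡1 d₀≤sum

-- (⇐, condition (ii)) s = d_1 + e_1 + ⋯ + e_{i-1} is below d, so it is a tail
-- subset sum; it exceeds e_1 + ⋯ + e_{i-1} since d_1 > 0, so the gap lemma
-- gives e_i ≤ s.
entryBounded : ∀ {n} (d : Fin (suc n) → ℕ) → Positive d → Nondecreasing d →
  (∀ j → j < total d → RepresentableAvoidingFirst d j) →
  ∀ i → tail d i ≤ sumBelow d (suc i)
entryBounded d pos mono rep i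
  with representedByTail d s (rep s (+-monoʳ-< (d zero) (sumBelow<total (tail d) i (pos (suc i)))))
  where
    s : ℕ
    s = sumBelow d (suc i)
... | H , sum≡s with subsetSumGap (tail d) (nondecreasing-tail d mono) i H
...   | inj₂ eᵢ≤sum = subst (tail d i ≤_) sum≡s eᵢ≤sum
...   | inj₁ sum≤below = ⊥-elim (<⇒≱ below<s (subst (_≤ sumBelow (tail d) i) sum≡s sum≤below))
  where
    below<s : sumBelow (tail d) i < d zero + sumBelow (tail d) i
    below<s = m<n+m (sumBelow (tail d) i) (pos zero)

proposition1 : (n : ℕ) (d : Fin (suc n) → ℕ) → Positive d → Nondecreasing d →
    Valid d ⇔ ((j : ℕ) → j < total d →
    Σ (Subset (suc n)) (λ H → (zero ∉ H) × (subsetSum H d ≡ j)))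
proposition1 _ d pos mono = mk⇔ (valid⇒representable d)
  (λ rep → firstIsOne d pos mono rep , entryBounded d pos mono rep)
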